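{- Let $n = p+q$ and let $u, v \in S_n$ be permutations such that in the one-line notation of $u$ the numbers $p, p-1, \dots, 1$ appear in descending order and the numbers $n, n-1, \dots, p+1$ appear in descending order (i.e. $u$ is a shuffle of these two sequences), and in the one-line notation of $v$ the numbers $1, \dots, p$ appear in ascending order and the numbers $p+1, \dots, n$ appear in ascending order. For each $i \in \{1,\dots,n\}$ define \[ F(u,v,i) = \#\{ j \mid 1 \le j \le i,\ u(j) > p,\ v(j) \le p\}, \qquad S(u,v,i) = \#\{ j \mid 1 \le j \le i,\ u(j) \le p,\ v(j) > p\}. \] Then $u \ge v$ in the Bruhat order if and only if $F(u,v,i) \ge S(u,v,i)$ for every $i = 1, \dots, n$.
   Context: The Bruhat order on $S_n$: $u \le v$ if and only if for every $i \in [n]$, when $\{u(1),\dots,u(i)\}$ and $\{v(1),\dots,v(i)\}$ are each arranged in ascending order, each element of the first set is less than or equal to the corresponding element of the second set. -}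

module Defs where

open import Data.Nat using (ℕ; _≤_; _<_; _≤?_; _<?_)
open import Data.Nat.Properties using (≤-decTotalOrder)
open import Data.Fin using (Fin; toℕ)
open import Data.Fin.Permutation using (Permutation′; _⟨$⟩ʳ_; _⟨$⟩ˡ_)
open import Data.List using (List; map; take; filter; length; allFin)
open import Data.List.Relation.Binary.Pointwise using (Pointwise)
open import Data.List.Sort ≤-decTotalOrder using (sort)
open import Relation.Nullary.Decidable using (_×-dec_)

-- Convention: S_n is modelled as Permutation′ n on Fin n; the value
-- u(j) ∈ {1..n} of the paper corresponds to toℕ (u ⟨$⟩ʳ j) + 1, and
-- position j ∈ {1..n} corresponds to the Fin index j-1.
-- Hence "u(j) ≤ p" is  toℕ (u ⟨$⟩ʳ j) < p  and "u(j) > p" is  p ≤ toℕ (u ⟨$⟩ʳ j).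

prefixVals : {n : ℕ} → Permutation′ n → ℕ → List ℕ
prefixVals {n} u i = map (λ j → toℕ (u ⟨$⟩ʳ j)) (take i (allFin n))

_≤B_ : {n : ℕ} → Permutation′ n → Permutation′ n → Set
_≤B_ {n} u v = (i : ℕ) → 1 ≤ i → i ≤ n →
  Pointwise _≤_ (sort (prefixVals u i)) (sort (prefixVals v i))

-- in u, the values p, p-1, ..., 1 appear in descending order and the
-- values n, ..., p+1 appear in descending order (positions = u⁻¹)
DescShuffle : (p : ℕ) {n : ℕ} → Permutation′ n → Set
DescShuffle p {n} u =
  ((a b : Fin n) → toℕ a < toℕ b → toℕ b < p → toℕ (u ⟨$⟩ˡ b) < toℕ (u ⟨$⟩ˡ a))
  × ((a b : Fin n) → toℕ a < toℕ b → p ≤ toℕ a → toℕ (u ⟨$⟩ˡ b) < toℕ (u ⟨$⟩ˡ a))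
  where open import Data.Product using (_×_)

AscShuffle : (p : ℕ) {n : ℕ} → Permutation′ n → Set
AscShuffle p {n} v =
  ((a b : Fin n) → toℕ a < toℕ b → toℕ b < p → toℕ (v ⟨$⟩ˡ a) < toℕ (v ⟨$⟩ˡ b))
  × ((a b : Fin n) → toℕ a < toℕ b → p ≤ toℕ a → toℕ (v ⟨$⟩ˡ a) < toℕ (v ⟨$⟩ˡ b))
  where open import Data.Product using (_×_)

F : (p : ℕ) {n : ℕ} → Permutation′ n → Permutation′ n → ℕ → ℕ
F p {n} u v i = length (filter (λ j → (p ≤? toℕ (u ⟨$⟩ʳ j)) ×-dec (toℕ (v ⟨$⟩ʳ j) <? p))
                               (take i (allFin n)))

S : (p : ℕ) {n : ℕ} → Permutation′ n → Permutation′ n → ℕ → ℕ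
S p {n} u v i = length (filter (λ j → (toℕ (u ⟨$⟩ʳ j) <? p) ×-dec (p ≤? toℕ (v ⟨$⟩ʳ j)))
                               (take i (allFin n)))

module Submission where

-- Values are 0-based, so "small" means < p.  For each i let U and V be the
-- sets of values among the first i entries of u and v.
--  * Counting small values (small-balance): |U ∩ [0,p)| + F = |V ∩ [0,p)| + S,
--    so S ≤ F iff |U ∩ [0,p)| ≤ |V ∩ [0,p)|.
--  * The Bruhat comparison at i (sorted-dominance) holds iff
--    |U ∩ [0,t)| ≤ |V ∩ [0,t)| for every threshold t.
--  Hence "⇒" is the threshold t = p.  For "⇐" the shuffle shapes matter:
--  V ∩ [0,p) is an initial segment of [0,p) and U ∩ [p,n) is a final segment
--  of [p,n), and for such sets the inequality at t = p propagates to all t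
--  (ShuffleDomination).  The counts |U ∩ [0,t)| are passed from positions to
--  values by reindexing a sum along the permutation (below-prefix).

open import Defs
open import Data.Bool.Base using (true; false; if_then_else_)
open import Data.Nat using (ℕ; zero; suc; _+_; _⊓_; _≤_; _<_; _≟_; _≤′_; ≤′-refl; ≤′-step; z≤n; s≤s; _≤?_; _<?_)
open import Data.Nat.Properties
open import Algebra.Properties.CommutativeSemigroup +-commutativeSemigroup using (interchange)
open import Algebra.Properties.CommutativeMonoid.Sum +-0-commutativeMonoid
  using (sum; sum-cong-≗; sum-permute; sum-init-last; sum-replicate-zero)
open import Data.Fin using (Fin; toℕ; fromℕ<)
open import Data.Fin.Properties using (toℕ<n; toℕ-fromℕ<; toℕ-injective; toℕ-inject₁; toℕ-fromℕ; any?)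
open import Data.Fin.Permutation using (Permutation′; _⟨$⟩ʳ_; _⟨$⟩ˡ_; inverseˡ)
open import Data.List using (List; []; _∷_; map; filter; length; take; tabulate; allFin)
open import Data.List.Properties using (filter-none; filter-some; filter-all; length-map)
open import Data.List.Relation.Unary.All.Properties using (map⁺)
open import Data.List.Relation.Unary.All as All using (All; _∷_)
open import Data.List.Relation.Unary.Any using (here)
open import Data.List.Relation.Unary.Linked as Linked using (Linked)
open import Data.List.Relation.Unary.Linked.Properties using (Linked⇒All)
open import Data.List.Relation.Binary.Pointwise using (Pointwise; []; _∷_)
open import Data.List.Relation.Binary.Permutation.Propositional using (_↭_)
open import Data.List.Relation.Binary.Permutation.Propositional.Properties using (↭-length; filter-↭)
open import Data.List.Sort ≤-decTotalOrder using (sort; sort-↭; sort-↗)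
open import Data.Product using (_×_; _,_; ∃-syntax; proj₁; proj₂)
open import Function.Base using (id; _∘_)
open import Data.Sum using (_⊎_; inj₁; inj₂)
open import Function.Bundles using (_⇔_; mk⇔; Equivalence)
open import Relation.Nullary using (Dec; does; ¬_; contradiction)
open import Relation.Nullary.Decidable using (yes; no; _×-dec_)
open import Relation.Unary using (Pred; Decidable)
open import Relation.Binary.PropositionalEquality

𝟙 : ∀ {a} {A : Set a} → Dec A → ℕ
𝟙 d = if does d then 1 else 0

𝟙≤1 : ∀ {a} {A : Set a} (d : Dec A) → 𝟙 d ≤ 1
𝟙≤1 (yes _) = s≤s z≤n
𝟙≤1 (no _)  = z≤n

𝟙-mono : ∀ {A B : Set} → (B → A) → (a? : Dec A) (b? : Dec B) → 𝟙 b? ≤ 𝟙 a?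
𝟙-mono _   (yes _) (yes _) = ≤-refl
𝟙-mono _   (yes _) (no _)  = z≤n
𝟙-mono _   (no _)  (no _)  = ≤-refl
𝟙-mono b⇒a (no ¬a) (yes b) = contradiction (b⇒a b) ¬a

𝟙-cong : ∀ {A B : Set} → (A → B) → (B → A) → (a? : Dec A) (b? : Dec B) → 𝟙 a? ≡ 𝟙 b?
𝟙-cong a⇒b b⇒a a? b? = ≤-antisym (𝟙-mono a⇒b b? a?) (𝟙-mono b⇒a a? b?)

𝟙-no : ∀ {A : Set} → ¬ A → (a? : Dec A) → 𝟙 a? ≡ 0
𝟙-no ¬a (yes a) = contradiction a ¬a
𝟙-no _  (no _)  = refl

below : ℕ → List ℕ → ℕ
below t xs = length (filter (_<? t) xs)

length-filter-∷ : ∀ {a} {A : Set a} {P : Pred A a} (P? : Decidable P) x xs →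
  length (filter P? (x ∷ xs)) ≡ 𝟙 (P? x) + length (filter P? xs)
length-filter-∷ P? x xs with does (P? x)
... | true  = refl
... | false = refl

balance : ∀ {a b x y} → a + x ≡ b + y → a ≤ b ⇔ y ≤ x
balance {a} {b} {x} {y} eq = mk⇔
  (λ a≤b → +-cancelˡ-≤ b y x (subst (_≤ b + x) eq (+-monoˡ-≤ x a≤b)))
  (λ y≤x → +-cancelʳ-≤ y a b (subst (a + y ≤_) eq (+-monoʳ-≤ a y≤x)))

-- For one position with
-- values x and y, "x small, or x large and y small" and "y small, or y large
-- and x small" both say "x or y is small", so their indicators agree.
small-or-large : ∀ {p x y} (x<p? : Dec (x < p)) (p≤x? : Dec (p ≤ x))
  (y<p? : Dec (y < p)) (p≤y? : Dec (p ≤ y)) →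
  𝟙 x<p? + 𝟙 (p≤x? ×-dec y<p?) ≡ 𝟙 y<p? + 𝟙 (x<p? ×-dec p≤y?)
small-or-large (yes x<p) (yes p≤x) _         _         = contradiction p≤x (<⇒≱ x<p)
small-or-large (no x≮p)  (no p≰x)  _         _         = contradiction (≮⇒≥ x≮p) p≰x
small-or-large _         _         (yes y<p) (yes p≤y) = contradiction p≤y (<⇒≱ y<p)
small-or-large _         _         (no y≮p)  (no p≰y)  = contradiction (≮⇒≥ y≮p) p≰y
small-or-large (yes _)   (no _)    (yes _)   (no _)    = refl
small-or-large (yes _)   (no _)    (no _)    (yes _)   = refl
small-or-large (no _)    (yes _)   (yes _)   (no _)    = refl
small-or-large (no _)    (yes _)   (no _)    (yes _)   = refl

small-balance : ∀ {A : Set} (f g : A → ℕ) p (js : List A) →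
  below p (map f js) + length (filter (λ j → (p ≤? f j) ×-dec (g j <? p)) js)
  ≡ below p (map g js) + length (filter (λ j → (f j <? p) ×-dec (p ≤? g j)) js)
small-balance f g p [] = refl
small-balance f g p (j ∷ js) = begin
  below p (f j ∷ map f js) + #large-small (j ∷ js)
    ≡⟨ cong₂ _+_ (length-filter-∷ (_<? p) (f j) (map f js)) (length-filter-∷ large-small? j js) ⟩
  (𝟙 (f j <? p) + below p (map f js)) + (𝟙 (large-small? j) + #large-small js)
    ≡⟨ interchange (𝟙 (f j <? p)) (below p (map f js)) (𝟙 (large-small? j)) (#large-small js) ⟩
  (𝟙 (f j <? p) + 𝟙 (large-small? j)) + (below p (map f js) + #large-small js)
    ≡⟨ cong₂ _+_ (small-or-large (f j <? p) (p ≤? f j) (g j <? p) (p ≤? g j)) (small-balance f g p js) ⟩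
  (𝟙 (g j <? p) + 𝟙 (small-large? j)) + (below p (map g js) + #small-large js)
    ≡⟨ interchange (𝟙 (g j <? p)) (𝟙 (small-large? j)) (below p (map g js)) (#small-large js) ⟩
  (𝟙 (g j <? p) + below p (map g js)) + (𝟙 (small-large? j) + #small-large js)
    ≡⟨ cong₂ _+_ (length-filter-∷ (_<? p) (g j) (map g js)) (length-filter-∷ small-large? j js) ⟨
  below p (g j ∷ map g js) + #small-large (j ∷ js) ∎
  where
  open ≡-Reasoning
  large-small? = λ k → (p ≤? f k) ×-dec (g k <? p)
  small-large? = λ k → (f k <? p) ×-dec (p ≤? g k)
  #large-small = λ ks → length (filter large-small? ks)
  #small-large = λ ks → length (filter small-large? ks)

below-↭ : ∀ t {xs ys} → xs ↭ ys → below t xs ≡ below t ys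
below-↭ t xs↭ys = ↭-length (filter-↭ (_<? t) xs↭ys)

pointwise⇒below : ∀ {xs ys} → Pointwise _≤_ xs ys → ∀ t → below t ys ≤ below t xs
pointwise⇒below [] t = z≤n
pointwise⇒below {x ∷ xs} {y ∷ ys} (x≤y ∷ xs≤ys) t = begin
  below t (y ∷ ys)         ≡⟨ length-filter-∷ (_<? t) y ys ⟩
  𝟙 (y <? t) + below t ys  ≤⟨ +-mono-≤ (𝟙-mono (≤-<-trans x≤y) (x <? t) (y <? t))
                                       (pointwise⇒below xs≤ys t) ⟩
  𝟙 (x <? t) + below t xs  ≡⟨ length-filter-∷ (_<? t) x xs ⟨
  below t (x ∷ xs)         ∎
  where open ≤-Reasoning

below-none : ∀ {t zs} → All (t ≤_) zs → below t zs ≡ 0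
below-none {t} t≤zs = cong length (filter-none (_<? t) (All.map ≤⇒≯ t≤zs))

sorted⇒head-≤ : ∀ {x xs} → Linked _≤_ (x ∷ xs) → All (x ≤_) (x ∷ xs)
sorted⇒head-≤ = Linked⇒All ≤-trans ≤-refl

-- Conversely, for sorted lists of equal length, domination of all threshold
-- counts gives entrywise domination: compare the heads at threshold x (the
-- minimum of x ∷ xs), then recurse on the tails.
below⇒pointwise : ∀ {xs ys} → Linked _≤_ xs → Linked _≤_ ys → length xs ≡ length ys →
  (∀ t → below t ys ≤ below t xs) → Pointwise _≤_ xs ys
below⇒pointwise {[]}     {[]}     _  _  _  _   = []
below⇒pointwise {x ∷ xs} {y ∷ ys} sx sy eq dom =
  x≤y ∷ below⇒pointwise (Linked.tail sx) (Linked.tail sy) (suc-injective eq) tails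
  where
  -- if y < x, then y lies below x while no entry of x ∷ xs does
  x≤y : x ≤ y
  x≤y = ≮⇒≥ λ y<x → <-irrefl refl
    (subst (0 <_) (below-none (sorted⇒head-≤ sx)) (≤-trans (filter-some (_<? x) (here y<x)) (dom x)))
  -- below t ≤ y nothing of y ∷ ys is counted; above y both heads are counted
  tails : ∀ t → below t ys ≤ below t xs
  tails t with t ≤? y | sorted⇒head-≤ sy
  ... | yes t≤y | _ ∷ y≤ys = subst (_≤ below t xs) (sym (below-none (All.map (≤-trans t≤y) y≤ys))) z≤n
  ... | no t≰y  | _ = +-cancelˡ-≤ (𝟙 (y <? t)) _ _ (begin
    𝟙 (y <? t) + below t ys  ≡⟨ length-filter-∷ (_<? t) y ys ⟨
    below t (y ∷ ys)         ≤⟨ dom t ⟩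
    below t (x ∷ xs)         ≡⟨ length-filter-∷ (_<? t) x xs ⟩
    𝟙 (x <? t) + below t xs  ≡⟨ cong (_+ below t xs) (𝟙-cong (λ _ → y<t) (λ _ → x<t) (x <? t) (y <? t)) ⟩
    𝟙 (y <? t) + below t xs  ∎)
    where
    open ≤-Reasoning
    y<t = ≰⇒> t≰y
    x<t = ≤-<-trans x≤y y<t

sorted-dominance : ∀ {xs ys} → length xs ≡ length ys →
  Pointwise _≤_ (sort xs) (sort ys) ⇔ (∀ t → below t ys ≤ below t xs)
sorted-dominance {xs} {ys} eq = mk⇔
  (λ pw t → subst₂ _≤_ (below-↭ t (sort-↭ ys)) (below-↭ t (sort-↭ xs)) (pointwise⇒below pw t))
  (λ dom → below⇒pointwise (sort-↗ xs) (sort-↗ ys) sorted-lengths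
    (λ t → subst₂ _≤_ (sym (below-↭ t (sort-↭ ys))) (sym (below-↭ t (sort-↭ xs))) (dom t)))
  where
  sorted-lengths : length (sort xs) ≡ length (sort ys)
  sorted-lengths = trans (↭-length (sort-↭ xs)) (trans eq (sym (↭-length (sort-↭ ys))))

count : ∀ {P : ℕ → Set} → Decidable P → ℕ → ℕ
count P? zero    = 0
count P? (suc t) = count P? t + 𝟙 (P? t)

module _ {P : ℕ → Set} (P? : Decidable P) where

  count-mono : ∀ {t t'} → t ≤′ t' → count P? t ≤ count P? t'
  count-mono ≤′-refl           = ≤-refl
  count-mono (≤′-step {t'} t≤t') = ≤-trans (count-mono t≤t') (m≤m+n _ (𝟙 (P? t')))

  -- each step adds at most one
  count-slope : ∀ {t t'} → t ≤′ t' → t + count P? t' ≤ t' + count P? t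
  count-slope ≤′-refl = ≤-refl
  count-slope {t} (≤′-step {t'} t≤t') = begin
    t + (count P? t' + 𝟙 (P? t'))  ≡⟨ +-assoc t _ _ ⟨
    (t + count P? t') + 𝟙 (P? t')  ≤⟨ +-mono-≤ (count-slope t≤t') (𝟙≤1 (P? t')) ⟩
    (t' + count P? t) + 1          ≡⟨ +-comm _ 1 ⟩
    suc t' + count P? t            ∎
    where open ≤-Reasoning

  -- if every value in [t, t') satisfies P, each step adds exactly one
  count-full : ∀ {t t'} → t ≤′ t' → (∀ {a} → t ≤ a → a < t' → P a) →
    t' + count P? t ≤ t + count P? t'
  count-full ≤′-refl _ = ≤-refl
  count-full {t} (≤′-step {t'} t≤t') full with P? t'
  ... | no ¬Pt' = contradiction (full (≤′⇒≤ t≤t') ≤-refl) ¬Pt'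
  ... | yes _   = begin
    suc (t' + count P? t)   ≤⟨ s≤s (count-full t≤t' (λ t≤a a<t' → full t≤a (m<n⇒m<1+n a<t'))) ⟩
    suc (t + count P? t')   ≡⟨ +-suc t _ ⟨
    t + suc (count P? t')   ≡⟨ cong (t +_) (+-comm 1 _) ⟩
    t + (count P? t' + 1)   ∎
    where open ≤-Reasoning

  count-flat-or-hit : ∀ {t t'} → t ≤′ t' →
    count P? t' ≡ count P? t ⊎ ∃[ a ] t ≤ a × a < t' × P a
  count-flat-or-hit ≤′-refl = inj₁ refl
  count-flat-or-hit (≤′-step {t'} t≤t') with P? t' | count-flat-or-hit t≤t'
  ... | yes Pt' | _ = inj₂ (t' , ≤′⇒≤ t≤t' , ≤-refl , Pt')
  ... | no _    | inj₁ flat = inj₁ (trans (+-identityʳ _) flat)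
  ... | no _    | inj₂ (a , t≤a , a<t' , Pa) = inj₂ (a , t≤a , m<n⇒m<1+n a<t' , Pa)

  count-saturate : ∀ {n t} → (∀ {a} → P a → a < n) → n ≤ t → count P? t ≡ count P? n
  count-saturate P⇒<n n≤t with count-flat-or-hit (≤⇒≤′ n≤t)
  ... | inj₁ flat = flat
  ... | inj₂ (a , n≤a , _ , Pa) = contradiction (P⇒<n Pa) (≤⇒≯ n≤a)

module ShuffleDomination {p n : ℕ} {U V : ℕ → Set} (U? : Decidable U) (V? : Decidable V)
  (U⊆n : ∀ {a} → U a → a < n) (V⊆n : ∀ {a} → V a → a < n)
  (V-initial : ∀ {a b} → a < b → b < p → V b → V a)
  (U-final : ∀ {a b} → p ≤ a → a < b → b < n → U a → U b)
  (same-size : count U? n ≡ count V? n)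
  (at-p : count U? p ≤ count V? p)
  where

  -- For t ≤ p: if V meets [t, p), then V ⊇ [0, t) and count V? t = t;
  -- otherwise count V? t = count V? p.
  up-to-p : ∀ {t} → t ≤ p → count U? t ≤ count V? t
  up-to-p {t} t≤p with count-flat-or-hit V? (≤⇒≤′ t≤p)
  ... | inj₁ flat = begin
    count U? t  ≤⟨ count-mono U? (≤⇒≤′ t≤p) ⟩
    count U? p  ≤⟨ at-p ⟩
    count V? p  ≡⟨ flat ⟩
    count V? t  ∎
    where open ≤-Reasoning
  ... | inj₂ (b , t≤b , b<p , Vb) = ≤-trans (count-slope U? z≤′n)
    (count-full V? z≤′n (λ _ a<t → V-initial (<-≤-trans a<t t≤b) b<p Vb))

  -- For p ≤ t ≤ n: if U meets [p, t), then U ⊇ [t, n), so U gains the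
  -- maximal amount from t to n while V gains at most that much;
  -- otherwise count U? t = count U? p.
  from-p-to-n : ∀ {t} → p ≤ t → t ≤ n → count U? t ≤ count V? t
  from-p-to-n {t} p≤t t≤n with count-flat-or-hit U? (≤⇒≤′ p≤t)
  ... | inj₁ flat = begin
    count U? t  ≡⟨ flat ⟩
    count U? p  ≤⟨ at-p ⟩
    count V? p  ≤⟨ count-mono V? (≤⇒≤′ p≤t) ⟩
    count V? t  ∎
    where open ≤-Reasoning
  ... | inj₂ (a , p≤a , a<t , Ua) = +-cancelˡ-≤ n _ _ (begin
    n + count U? t  ≤⟨ count-full U? (≤⇒≤′ t≤n) (λ t≤b b<n → U-final p≤a (<-≤-trans a<t t≤b) b<n Ua) ⟩
    t + count U? n  ≡⟨ cong (t +_) same-size ⟩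
    t + count V? n  ≤⟨ count-slope V? (≤⇒≤′ t≤n) ⟩
    n + count V? t  ∎)
    where open ≤-Reasoning

  -- For n ≤ t both sets are counted completely.
  from-n : ∀ {t} → n ≤ t → count U? t ≤ count V? t
  from-n n≤t = ≤-reflexive
    (trans (count-saturate U? U⊆n n≤t) (trans same-size (sym (count-saturate V? V⊆n n≤t))))

  dominates : ∀ t → count U? t ≤ count V? t
  dominates t with t ≤? p | t ≤? n
  ... | yes t≤p | _       = up-to-p t≤p
  ... | no t≰p  | yes t≤n = from-p-to-n (<⇒≤ (≰⇒> t≰p)) t≤n
  ... | no _    | no t≰n  = from-n (<⇒≤ (≰⇒> t≰n))

below-take : ∀ {A : Set} {m} (h : A → ℕ) (e : Fin m → A) i t →
  below t (map h (take i (tabulate e))) ≡ sum (λ j → 𝟙 ((toℕ j <? i) ×-dec (h (e j) <? t)))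
below-take {m = zero}  h e zero    t = refl
below-take {m = zero}  h e (suc i) t = refl
below-take {m = suc m} h e zero    t = sym (sum-replicate-zero (suc m))
below-take {m = suc m} h e (suc i) t =
  trans (length-filter-∷ (_<? t) (h (e Fin.zero)) _)
        (cong (𝟙 (h (e Fin.zero) <? t) +_) (below-take h (λ j → e (Fin.suc j)) i t))

sum-toℕ : ∀ {P : ℕ → Set} (P? : Decidable P) n → sum (λ (x : Fin n) → 𝟙 (P? (toℕ x))) ≡ count P? n
sum-toℕ P? zero    = refl
sum-toℕ P? (suc n) = trans (sum-init-last {n} (λ x → 𝟙 (P? (toℕ x))))
  (cong₂ _+_ (trans (sum-cong-≗ {n} (λ x → cong (λ a → 𝟙 (P? a)) (toℕ-inject₁ x))) (sum-toℕ P? n))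
             (cong (λ a → 𝟙 (P? a)) (toℕ-fromℕ n)))

module _ {P : ℕ → Set} (P? : Decidable P) where

  restrict? : ∀ t → Decidable (λ a → P a × a < t)
  restrict? t a = P? a ×-dec (a <? t)

  count-⊓ : ∀ t m → count (restrict? t) m ≡ count P? (m ⊓ t)
  count-⊓ t zero    = refl
  count-⊓ t (suc m) with m <? t
  ... | yes m<t = begin
    count (restrict? t) m + 𝟙 (restrict? t m)
      ≡⟨ cong₂ _+_ (count-⊓ t m) (𝟙-cong proj₁ (_, m<t) (restrict? t m) (P? m)) ⟩
    count P? (m ⊓ t) + 𝟙 (P? m)
      ≡⟨ cong (λ k → count P? k + 𝟙 (P? m)) (m≤n⇒m⊓n≡m (<⇒≤ m<t)) ⟩
    count P? (suc m)
      ≡⟨ cong (count P?) (m≤n⇒m⊓n≡m m<t) ⟨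
    count P? (suc m ⊓ t) ∎
    where open ≡-Reasoning
  ... | no m≮t = begin
    count (restrict? t) m + 𝟙 (restrict? t m)
      ≡⟨ cong₂ _+_ (count-⊓ t m) (𝟙-no (m≮t ∘ proj₂) (restrict? t m)) ⟩
    count P? (m ⊓ t) + 0
      ≡⟨ +-identityʳ _ ⟩
    count P? (m ⊓ t)
      ≡⟨ cong (count P?) (m≥n⇒m⊓n≡n t≤m) ⟩
    count P? t
      ≡⟨ cong (count P?) (m≥n⇒m⊓n≡n (m≤n⇒m≤1+n t≤m)) ⟨
    count P? (suc m ⊓ t) ∎
    where
    open ≡-Reasoning
    t≤m = ≮⇒≥ m≮t

  count-restrict : ∀ {n t} → (∀ {a} → P a → a < n) →
    count (restrict? t) n ≡ count P? t
  count-restrict {n} {t} P⇒<n with t ≤? n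
  ... | yes t≤n = trans (count-⊓ t n) (cong (count P?) (m≥n⇒m⊓n≡n t≤n))
  ... | no t≰n  = trans (count-⊓ t n) (trans (cong (count P?) (m≤n⇒m⊓n≡m n≤t))
                                              (sym (count-saturate P? P⇒<n n≤t)))
    where n≤t = <⇒≤ (≰⇒> t≰n)

InPrefix : ∀ {n} → Permutation′ n → ℕ → ℕ → Set
InPrefix π i a = ∃[ x ] toℕ x ≡ a × toℕ (π ⟨$⟩ˡ x) < i

inPrefix? : ∀ {n} (π : Permutation′ n) i → Decidable (InPrefix π i)
inPrefix? π i a = any? (λ x → (toℕ x ≟ a) ×-dec (toℕ (π ⟨$⟩ˡ x) <? i))

inPrefix-< : ∀ {n} {π : Permutation′ n} {i a} → InPrefix π i a → a < n
inPrefix-< (x , refl , _) = toℕ<n x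

inPrefix-toℕ : ∀ {n} {π : Permutation′ n} {i} (x : Fin n) →
  InPrefix π i (toℕ x) → toℕ (π ⟨$⟩ˡ x) < i
inPrefix-toℕ {π = π} {i} x (y , y≡x , y-early) = subst (λ z → toℕ (π ⟨$⟩ˡ z) < i) (toℕ-injective y≡x) y-early

-- Reindex the sum over positions j by the values π j.
below-prefix : ∀ {n} (π : Permutation′ n) i t → below t (prefixVals π i) ≡ count (inPrefix? π i) t
below-prefix {n} π i t = begin
  below t (prefixVals π i)
    ≡⟨ below-take (λ j → toℕ (π ⟨$⟩ʳ j)) id i t ⟩
  sum {n} (λ j → 𝟙 ((toℕ j <? i) ×-dec (toℕ (π ⟨$⟩ʳ j) <? t)))
    ≡⟨ sum-cong-≗ {n} (λ j → cong (λ k → 𝟙 ((toℕ k <? i) ×-dec (toℕ (π ⟨$⟩ʳ j) <? t))) (inverseˡ π)) ⟨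
  sum {n} (λ j → early-below (π ⟨$⟩ʳ j))
    ≡⟨ sum-permute early-below π ⟨
  sum {n} early-below
    ≡⟨ sum-cong-≗ {n} (λ x → 𝟙-cong (λ (early , x<t) → (x , refl , early) , x<t)
                                    (λ (occurs , x<t) → inPrefix-toℕ {π = π} x occurs , x<t)
                                    ((toℕ (π ⟨$⟩ˡ x) <? i) ×-dec (toℕ x <? t)) (occurs-below? (toℕ x))) ⟩
  sum {n} (λ x → 𝟙 (occurs-below? (toℕ x)))
    ≡⟨ sum-toℕ occurs-below? n ⟩
  count occurs-below? n
    ≡⟨ count-restrict (inPrefix? π i) (inPrefix-< {π = π}) ⟩
  count (inPrefix? π i) t ∎
  where
  open ≡-Reasoning
  early-below : Fin n → ℕ
  early-below x = 𝟙 ((toℕ (π ⟨$⟩ˡ x) <? i) ×-dec (toℕ x <? t))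
  occurs-below? : Decidable (λ a → InPrefix π i a × a < t)
  occurs-below? = restrict? (inPrefix? π i) t

inPrefix-size : ∀ {n} (π : Permutation′ n) i → count (inPrefix? π i) n ≡ length (take i (allFin n))
inPrefix-size {n} π i = begin
  count (inPrefix? π i) n         ≡⟨ below-prefix π i n ⟨
  below n (prefixVals π i)        ≡⟨ cong length (filter-all (_<? n) (map⁺ (All.universal (λ j → toℕ<n (π ⟨$⟩ʳ j)) (take i (allFin n))))) ⟩
  length (prefixVals π i)         ≡⟨ length-map (λ j → toℕ (π ⟨$⟩ʳ j)) (take i (allFin n)) ⟩
  length (take i (allFin n))      ∎
  where open ≡-Reasoning

-- In v the values below p appear in increasing order, so those among the
-- first i entries form an initial segment of [0, p).
asc-initial : ∀ {p n} {v : Permutation′ n} {i} → AscShuffle p v →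
  ∀ {a b} → a < b → b < p → InPrefix v i b → InPrefix v i a
asc-initial (asc , _) {a} a<b b<p (y , refl , y-early) =
  x , toℕ-fromℕ< a<n , <-trans (asc x y (subst (_< toℕ y) (sym (toℕ-fromℕ< a<n)) a<b) b<p) y-early
  where
  a<n = <-trans a<b (toℕ<n y)
  x = fromℕ< a<n

-- In u the values from p on appear in decreasing order, so those among the
-- first i entries form a final segment of [p, n).
desc-final : ∀ {p n} {u : Permutation′ n} {i} → DescShuffle p u →
  ∀ {a b} → p ≤ a → a < b → b < n → InPrefix u i a → InPrefix u i b
desc-final (_ , desc) p≤a a<b b<n (x , refl , x-early) =
  y , toℕ-fromℕ< b<n , <-trans (desc x y (subst (toℕ x <_) (sym (toℕ-fromℕ< b<n)) a<b) p≤a) x-early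
  where
  y = fromℕ< b<n

lemma3p6 : (p q : ℕ) (u v : Permutation′ (p + q)) →
    DescShuffle p u → AscShuffle p v →
    (v ≤B u ⇔ ((i : ℕ) → 1 ≤ i → i ≤ p + q → S p u v i ≤ F p u v i))
lemma3p6 p q u v u-desc v-asc = mk⇔ to from
  where
  n = p + q

  -- below p counts the small values; their difference between u and v is F - S
  balanceᵢ : ∀ i → below p (prefixVals u i) ≤ below p (prefixVals v i) ⇔ S p u v i ≤ F p u v i
  balanceᵢ i = balance (small-balance (λ j → toℕ (u ⟨$⟩ʳ j)) (λ j → toℕ (v ⟨$⟩ʳ j)) p (take i (allFin n)))

  dominanceᵢ : ∀ i → Pointwise _≤_ (sort (prefixVals v i)) (sort (prefixVals u i))
                     ⇔ (∀ t → below t (prefixVals u i) ≤ below t (prefixVals v i))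
  dominanceᵢ i = sorted-dominance (trans (length-map _ (take i (allFin n))) (sym (length-map _ (take i (allFin n)))))

  -- the Bruhat condition at threshold p is exactly S ≤ F
  to : v ≤B u → ∀ i → 1 ≤ i → i ≤ n → S p u v i ≤ F p u v i
  to v≤u i 1≤i i≤n = Equivalence.to (balanceᵢ i) (Equivalence.to (dominanceᵢ i) (v≤u i 1≤i i≤n) p)

  -- S ≤ F gives the threshold p; the shuffle shapes propagate it to every t
  from : (∀ i → 1 ≤ i → i ≤ n → S p u v i ≤ F p u v i) → v ≤B u
  from S≤F i 1≤i i≤n = Equivalence.from (dominanceᵢ i) λ t →
    subst₂ _≤_ (sym (below-prefix u i t)) (sym (below-prefix v i t)) (dominates t)
    where
    open ShuffleDomination (inPrefix? u i) (inPrefix? v i)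
      (inPrefix-< {π = u}) (inPrefix-< {π = v}) (asc-initial {p} {v = v} {i} v-asc) (desc-final {p} {u = u} {i} u-desc)
      (trans (inPrefix-size u i) (sym (inPrefix-size v i)))
      (subst₂ _≤_ (below-prefix u i p) (below-prefix v i p)
        (Equivalence.from (balanceᵢ i) (S≤F i 1≤i i≤n)))
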